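{- Let $G=(X,Y,E)$ be a connected bipartite graph. Then $G$ is Parikh binary word representable if and only if for all $x,x'\in X$, $N(x)\subseteq N(x')$ or $N(x')\subseteq N(x)$.
   Context: $N(v)$ denotes the open neighborhood of a vertex $v$. For an ordered alphabet $\Sigma=\{a_1<\dots<a_s\}$ and a nonempty word $w=w_1\cdots w_n$ over $\Sigma$, the Parikh graph $\mathcal{G}(w)$ is the simple undirected graph on $\{1,\dots,n\}$ where, for $i<j$, $i$ and $j$ are adjacent iff $w_i=a_k$ and $w_j=a_{k+1}$ for some $1\le k\le s-1$. A graph is Parikh binary word representable if it is isomorphic to $\mathcal{G}(w)$ for some nonempty word $w$ over an ordered alphabet with exactly two letters (equivalently, over $\{a<b\}$). -}

module Defs where

open import Data.Nat using (ℕ; suc)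
open import Data.Fin using (Fin; _<?_)
open import Data.Vec using (Vec; lookup)
open import Data.Bool using (Bool; true; false)
open import Data.Sum using (_⊎_; inj₁; inj₂)
open import Data.Product using (Σ; ∃; _×_)
open import Function.Bundles using (_↔_; Inverse)
open import Relation.Nullary using (yes; no)
open import Relation.Binary.PropositionalEquality using (_≡_)

data Letter : Set where
  a b : Letter

Isomorphic : {V W : Set} → (V → V → Bool) → (W → W → Bool) → Set
Isomorphic {V} {W} A B =
  Σ (V ↔ W) λ f → ∀ u v → A u v ≡ B (Inverse.to f u) (Inverse.to f v)

-- "w_i = a_k and w_j = a_(k+1) for some k" over {a < b}: w_i = a, w_j = b.
ParikhEdge : Letter → Letter → Bool
ParikhEdge a b = true
ParikhEdge _ _ = false

-- Parikh graph G(w) on vertices Fin n (positions 1..n shifted to 0..n-1):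
-- for i < j, i ~ j iff ParikhEdge w_i w_j; symmetric; no loops.
ParikhAdj : {n : ℕ} → Vec Letter n → Fin n → Fin n → Bool
ParikhAdj w i j with i <? j | j <? i
... | yes _ | _     = ParikhEdge (lookup w i) (lookup w j)
... | no _  | yes _ = ParikhEdge (lookup w j) (lookup w i)
... | no _  | no _  = false

ParikhBinaryRepresentable : {V : Set} → (V → V → Bool) → Set
ParikhBinaryRepresentable A =
  Σ ℕ λ m → Σ (Vec Letter (suc m)) λ w → Isomorphic A (ParikhAdj w)

-- Walks and connectedness (a connected graph has at least one vertex).
data Walk {V : Set} (A : V → V → Bool) : V → V → Set where
  here : ∀ {u} → Walk A u u
  step : ∀ {u v w} → A u v ≡ true → Walk A v w → Walk A u w

Connected : {V : Set} → (V → V → Bool) → Set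
Connected {V} A = V × (∀ u v → Walk A u v)

BipGraph : ℕ → ℕ → Set
BipGraph p q = Fin p → Fin q → Bool

bipAdj : {p q : ℕ} → BipGraph p q → (Fin p ⊎ Fin q) → (Fin p ⊎ Fin q) → Bool
bipAdj E (inj₁ x) (inj₂ y) = E x y
bipAdj E (inj₂ y) (inj₁ x) = E x y
bipAdj E _ _ = false

-- N(x) ⊆ N(x') for x, x' ∈ X (neighbourhoods of X-vertices lie in Y).
NbhdSubset : {p q : ℕ} → BipGraph p q → Fin p → Fin p → Set
NbhdSubset E x x' = ∀ y → E x y ≡ true → E x' y ≡ true

module Submission where

-- In G(w) every edge joins an occurrence of a with a LATER
-- occurrence of b, so adjacent positions carry different letters.  Hence along
-- any walk the letter flips with the side of the bipartition, and in a
-- connected graph all X-vertices carry the same letter.  Two occurrences of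
-- the same letter have nested neighbourhoods in G(w) (an earlier a sees every
-- b a later a sees; a later b sees every a an earlier b sees).
--
-- If the neighbourhoods are nested, then x ~ y iff
-- richer x < coDegree y, where richer x counts the X-vertices of strictly
-- larger degree and coDegree y the neighbours of y.  Interleaving these two
-- thresholds into one key (odd for X, even for Y), sorting the vertices by
-- key and writing a for X-vertices and b for Y-vertices yields a word whose
-- Parikh graph is G.  Sorting is done by ranking: the position of a vertex is
-- the number of vertices of smaller (tie-broken, hence injective) key.

open import Defs
open import Data.Nat using (ℕ; zero; suc; _+_; _*_; _≤_; _<_; _<ᵇ_; s≤s)
open import Data.Nat.Properties
  using (<-trans; <⇒≤; <⇒≱; *-suc; ≤-<-trans; <-≤-trans; <-irrefl; <-asym; <⇒≢; ≰⇒>;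
         ≤-total; <-cmp; m≤m+n; +-comm; +-monoʳ-<; *-monoˡ-≤; *-monoʳ-≤;
         +-cancelˡ-≡; <ᵇ⇒<; <⇒<ᵇ; n<1+n; module ≤-Reasoning)
open import Data.Fin using (Fin; toℕ; fromℕ<; punchOut; _<?_)
open import Data.Fin.Properties
  using (toℕ<n; toℕ-fromℕ<; toℕ-injective; punchOut-injective; <⇒notInjective;
         any?; _≟_; +↔⊎)
open import Data.Fin.Subset using (∣_∣; _∈_)
open import Data.Fin.Subset.Properties using (p⊆q⇒∣p∣≤∣q∣; p⊂q⇒∣p∣<∣q∣; ∈⊤; ⊆⊤; ∣⊤∣≡n)
open import Data.Vec using (Vec; lookup; tabulate)
open import Data.Vec.Properties using (lookup∘tabulate; []=⇒lookup; lookup⇒[]=)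
open import Data.Bool using (Bool; true; false)
open import Data.Bool.Properties as Bool using (T-≡; ⇔→≡; ¬-not)
open import Data.Empty using (⊥-elim)
open import Data.Sum as Sum using (_⊎_; inj₁; inj₂; swap)
open import Data.Product using (Σ; ∃; _×_; _,_; proj₁; proj₂)
open import Relation.Nullary using (¬_; yes; no; contradiction)
open import Relation.Binary using (tri<; tri≈; tri>)
open import Relation.Binary.PropositionalEquality
  using (_≡_; _≢_; refl; sym; trans; cong; subst; subst₂)
open import Function using (_∘_)
open import Function.Bundles using (_↔_; Inverse; mk↔ₛ′; _⇔_; mk⇔; Equivalence)
open import Function.Definitions using (Injective)
open import Function.Construct.Composition using (_↔-∘_; _⇔-∘_)
open import Function.Construct.Symmetry using (↔-sym; ⇔-sym)

count : {n : ℕ} → (Fin n → Bool) → ℕ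
count f = ∣ tabulate f ∣

∈-tabulate : {n : ℕ} {f : Fin n → Bool} {i : Fin n} → f i ≡ true → i ∈ tabulate f
∈-tabulate {f = f} {i} fi = lookup⇒[]= i (tabulate f) (trans (lookup∘tabulate f i) fi)

tabulate-∈ : {n : ℕ} {f : Fin n → Bool} {i : Fin n} → i ∈ tabulate f → f i ≡ true
tabulate-∈ {f = f} {i} i∈f = trans (sym (lookup∘tabulate f i)) ([]=⇒lookup i∈f)

count-mono : {n : ℕ} (f g : Fin n → Bool) →
  (∀ i → f i ≡ true → g i ≡ true) → count f ≤ count g
count-mono f g f⇒g = p⊆q⇒∣p∣≤∣q∣ {p = tabulate f} {q = tabulate g}
  (∈-tabulate ∘ f⇒g _ ∘ tabulate-∈)

count-strict : {n : ℕ} (f g : Fin n → Bool) →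
  (∀ i → f i ≡ true → g i ≡ true) →
  (k : Fin n) → ¬ (f k ≡ true) → g k ≡ true → count f < count g
count-strict f g f⇒g k ¬fk gk = p⊂q⇒∣p∣<∣q∣ {p = tabulate f} {q = tabulate g}
  ((∈-tabulate ∘ f⇒g _ ∘ tabulate-∈) , k , ∈-tabulate gk , ¬fk ∘ tabulate-∈)

count<n : {n : ℕ} (f : Fin n → Bool) (k : Fin n) → ¬ (f k ≡ true) → count f < n
count<n {n} f k ¬fk =
  subst (count f <_) (∣⊤∣≡n n) (p⊂q⇒∣p∣<∣q∣ {p = tabulate f} (⊆⊤ , k , ∈⊤ , ¬fk ∘ tabulate-∈))

<ᵇ-true : {m n : ℕ} → m < n → (m <ᵇ n) ≡ true
<ᵇ-true = Equivalence.to T-≡ ∘ <⇒<ᵇ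

<ᵇ-true⁻¹ : (m n : ℕ) → (m <ᵇ n) ≡ true → m < n
<ᵇ-true⁻¹ m n = <ᵇ⇒< m n ∘ Equivalence.from T-≡

<ᵇ-irrefl : (n : ℕ) → ¬ ((n <ᵇ n) ≡ true)
<ᵇ-irrefl n = <-irrefl refl ∘ <ᵇ-true⁻¹ n n

-- Sorting a finite set by a natural-number key

-- An injective endomap of Fin n is surjective: a missed value k would let
-- punchOut k squeeze Fin n injectively into Fin (n - 1).
injective⇒surjective : {n : ℕ} (f : Fin n → Fin n) → Injective _≡_ _≡_ f →
  ∀ k → ∃ λ i → f i ≡ k
injective⇒surjective {suc m} f f-inj k with any? (λ i → f i ≟ k)
... | yes hit = hit
... | no miss = ⊥-elim (<⇒notInjective (n<1+n m) squeezed)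
  where
  k≢f : ∀ i → k ≢ f i
  k≢f i k≡fi = miss (i , sym k≡fi)

  squeezed : Injective _≡_ _≡_ (λ i → punchOut (k≢f i))
  squeezed {i} {j} = f-inj ∘ punchOut-injective (k≢f i) (k≢f j)

injective⇒↔ : {n : ℕ} (f : Fin n → Fin n) → Injective _≡_ _≡_ f → Fin n ↔ Fin n
injective⇒↔ f f-inj = mk↔ₛ′ f (λ k → proj₁ (surj k)) (λ k → proj₂ (surj k))
  (λ i → f-inj (proj₂ (surj (f i))))
  where
  surj : ∀ k → ∃ λ i → f i ≡ k
  surj = injective⇒surjective f f-inj

-- An injective key sorts Fin n: sending j to the number of i with smaller key
-- is a permutation that is strictly monotone with respect to the key.
rankPermutation : {n : ℕ} (K : Fin n → ℕ) → Injective _≡_ _≡_ K →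
  Σ (Fin n ↔ Fin n) λ ρ → ∀ {i j} → K i < K j →
    toℕ (Inverse.to ρ i) < toℕ (Inverse.to ρ j)
rankPermutation {n} K K-inj = injective⇒↔ position position-injective , position-mono
  where
  below : Fin n → Fin n → Bool
  below j i = K i <ᵇ K j

  rank : Fin n → ℕ
  rank j = count (below j)

  rank-mono : ∀ {i j} → K i < K j → rank i < rank j
  rank-mono {i} {j} Ki<Kj = count-strict (below i) (below j)
    (λ k Kk<Ki → <ᵇ-true (<-trans (<ᵇ-true⁻¹ (K k) (K i) Kk<Ki) Ki<Kj))
    i (<ᵇ-irrefl (K i)) (<ᵇ-true Ki<Kj)

  position : Fin n → Fin n
  position j = fromℕ< (count<n (below j) j (<ᵇ-irrefl (K j)))

  position-mono : ∀ {i j} → K i < K j → toℕ (position i) < toℕ (position j)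
  position-mono Ki<Kj = subst₂ _<_ (sym (toℕ-fromℕ< _)) (sym (toℕ-fromℕ< _)) (rank-mono Ki<Kj)

  position-injective : Injective _≡_ _≡_ position
  position-injective {i} {j} same with <-cmp (K i) (K j)
  ... | tri< lt _ _ = contradiction (cong toℕ same) (<⇒≢ (position-mono lt))
  ... | tri≈ _ eq _ = K-inj eq
  ... | tri> _ _ gt = contradiction (cong toℕ (sym same)) (<⇒≢ (position-mono gt))

lex-< : ∀ {α β r s n} → α < β → r < n → α * n + r < β * n + s
lex-< {α} {β} {r} {s} {n} α<β r<n = begin-strict
  α * n + r <⟨ +-monoʳ-< (α * n) r<n ⟩
  α * n + n ≡⟨ +-comm (α * n) n ⟩
  suc α * n ≤⟨ *-monoˡ-≤ n α<β ⟩
  β * n     ≤⟨ m≤m+n (β * n) s ⟩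
  β * n + s ∎
  where open ≤-Reasoning

tieBreak : {n : ℕ} → (Fin n → ℕ) → Fin n → ℕ
tieBreak {n} key i = key i * n + toℕ i

tieBreak-mono : {n : ℕ} (key : Fin n → ℕ) {i j : Fin n} →
  key i < key j → tieBreak key i < tieBreak key j
tieBreak-mono key {i} lt = lex-< lt (toℕ<n i)

tieBreak-injective : {n : ℕ} (key : Fin n → ℕ) → Injective _≡_ _≡_ (tieBreak key)
tieBreak-injective {n} key {i} {j} same with <-cmp (key i) (key j)
... | tri< lt _ _ = contradiction same (<⇒≢ (tieBreak-mono key lt))
... | tri> _ _ gt = contradiction (sym same) (<⇒≢ (tieBreak-mono key gt))
... | tri≈ _ eq _ rewrite eq = toℕ-injective (+-cancelˡ-≡ (key j * n) _ _ same)

sortBy : {V : Set} {n : ℕ} → V ↔ Fin n → (key : V → ℕ) →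
  Σ (V ↔ Fin n) λ σ → ∀ {u v} → key u < key v →
    toℕ (Inverse.to σ u) < toℕ (Inverse.to σ v)
sortBy {V} {n} e key = ρ ↔-∘ e , monotone
  where
  open Inverse e using (to; from; strictlyInverseʳ)

  keyFin : Fin n → ℕ
  keyFin = key ∘ from

  ranking : Σ (Fin n ↔ Fin n) λ ρ → ∀ {i j} → tieBreak keyFin i < tieBreak keyFin j →
    toℕ (Inverse.to ρ i) < toℕ (Inverse.to ρ j)
  ranking = rankPermutation (tieBreak keyFin) (tieBreak-injective keyFin)

  ρ : Fin n ↔ Fin n
  ρ = proj₁ ranking

  monotone : ∀ {u v} → key u < key v → toℕ (Inverse.to ρ (to u)) < toℕ (Inverse.to ρ (to v))
  monotone {u} {v} lt = proj₂ ranking (tieBreak-mono keyFin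
    (subst₂ _<_ (sym (cong key (strictlyInverseʳ u))) (sym (cong key (strictlyInverseʳ v))) lt))

flip : Letter → Letter
flip a = b
flip b = a

edge⇒ab : ∀ l l' → ParikhEdge l l' ≡ true → l ≡ a × l' ≡ b
edge⇒ab a b _ = refl , refl
edge⇒ab a a ()
edge⇒ab b _ ()

Arc : {n : ℕ} → Vec Letter n → Fin n → Fin n → Set
Arc w i j = toℕ i < toℕ j × lookup w i ≡ a × lookup w j ≡ b

adjacent⇒arc : {n : ℕ} (w : Vec Letter n) (i j : Fin n) →
  ParikhAdj w i j ≡ true → Arc w i j ⊎ Arc w j i
adjacent⇒arc w i j adj with i <? j | j <? i
... | yes i<j | _       = inj₁ (i<j , edge⇒ab _ _ adj)
... | no _    | yes j<i = inj₂ (j<i , edge⇒ab _ _ adj)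
... | no _    | no _    = contradiction adj λ ()

arc⇒adjacent : {n : ℕ} (w : Vec Letter n) (i j : Fin n) →
  Arc w i j ⊎ Arc w j i → ParikhAdj w i j ≡ true
arc⇒adjacent w i j arc with i <? j | j <? i | arc
... | yes _   | _       | inj₁ (_ , wi≡a , wj≡b) rewrite wi≡a | wj≡b = refl
... | yes i<j | _       | inj₂ (j<i , _ , _) = contradiction (<-trans i<j j<i) (<-irrefl refl)
... | no i≮j  | _       | inj₁ (i<j , _ , _) = contradiction i<j i≮j
... | no _    | yes _   | inj₂ (_ , wj≡a , wi≡b) rewrite wj≡a | wi≡b = refl
... | no _    | no j≮i  | inj₂ (j<i , _ , _) = contradiction j<i j≮i

parikhAdj-sym : {n : ℕ} (w : Vec Letter n) (i j : Fin n) → ParikhAdj w i j ≡ ParikhAdj w j i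
parikhAdj-sym w i j = ⇔→≡ (mk⇔ (arc⇒adjacent w j i ∘ swap ∘ adjacent⇒arc w i j)
                               (arc⇒adjacent w i j ∘ swap ∘ adjacent⇒arc w j i))

adjacent⇒flipped : {n : ℕ} (w : Vec Letter n) (i j : Fin n) →
  ParikhAdj w i j ≡ true → lookup w i ≡ flip (lookup w j)
adjacent⇒flipped w i j adj with adjacent⇒arc w i j adj
... | inj₁ (_ , wi≡a , wj≡b) = trans wi≡a (cong flip (sym wj≡b))
... | inj₂ (_ , wj≡a , wi≡b) = trans wi≡b (cong flip (sym wj≡a))

flip-≢ : ∀ l → flip l ≢ l
flip-≢ a ()
flip-≢ b ()

sameLetter⇒nonadjacent : {n : ℕ} (w : Vec Letter n) (i j : Fin n) →
  lookup w i ≡ lookup w j → ParikhAdj w i j ≡ false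
sameLetter⇒nonadjacent w i j same = ¬-not λ adj →
  flip-≢ (lookup w j) (trans (sym (adjacent⇒flipped w i j adj)) same)

adjacent⇔before : {n : ℕ} (w : Vec Letter n) (i j : Fin n) →
  lookup w i ≡ a → lookup w j ≡ b → (ParikhAdj w i j ≡ true ⇔ toℕ i < toℕ j)
adjacent⇔before w i j wi≡a wj≡b = mk⇔ before (λ i<j → arc⇒adjacent w i j (inj₁ (i<j , wi≡a , wj≡b)))
  where
  before : ParikhAdj w i j ≡ true → toℕ i < toℕ j
  before adj with adjacent⇒arc w i j adj
  ... | inj₁ (i<j , _ , _) = i<j
  ... | inj₂ (_ , wj≡a , _) = contradiction (trans (sym wj≡a) wj≡b) λ ()

Nbhd⊆ : {n : ℕ} → Vec Letter n → Fin n → Fin n → Set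
Nbhd⊆ w i i' = ∀ j → ParikhAdj w i j ≡ true → ParikhAdj w i' j ≡ true

a-nested : {n : ℕ} (w : Vec Letter n) {i i' : Fin n} →
  lookup w i ≡ a → lookup w i' ≡ a → toℕ i ≤ toℕ i' → Nbhd⊆ w i' i
a-nested w {i} {i'} wi≡a wi'≡a i≤i' j adj with adjacent⇒arc w i' j adj
... | inj₁ (i'<j , _ , wj≡b) = arc⇒adjacent w i j (inj₁ (≤-<-trans i≤i' i'<j , wi≡a , wj≡b))
... | inj₂ (_ , _ , wi'≡b) = contradiction (trans (sym wi'≡a) wi'≡b) λ ()

b-nested : {n : ℕ} (w : Vec Letter n) {i i' : Fin n} →
  lookup w i ≡ b → lookup w i' ≡ b → toℕ i ≤ toℕ i' → Nbhd⊆ w i i'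
b-nested w {i} {i'} wi≡b wi'≡b i≤i' j adj with adjacent⇒arc w i j adj
... | inj₁ (_ , wi≡a , _) = contradiction (trans (sym wi≡a) wi≡b) λ ()
... | inj₂ (j<i , wj≡a , _) = arc⇒adjacent w i' j (inj₂ (<-≤-trans j<i i≤i' , wj≡a , wi'≡b))

sameLetter⇒nested : {n : ℕ} (w : Vec Letter n) {i i' : Fin n} {l : Letter} →
  lookup w i ≡ l → lookup w i' ≡ l → toℕ i ≤ toℕ i' → Nbhd⊆ w i i' ⊎ Nbhd⊆ w i' i
sameLetter⇒nested w {l = a} wi≡a wi'≡a i≤i' = inj₂ (a-nested w wi≡a wi'≡a i≤i')
sameLetter⇒nested w {l = b} wi≡b wi'≡b i≤i' = inj₁ (b-nested w wi≡b wi'≡b i≤i')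

-- Necessity: a Parikh representation forces nested X-neighbourhoods

-- Only an adjacency-preserving-and-reflecting map φ into G(w) is needed.
module Necessity {p q n : ℕ} (E : BipGraph p q) (w : Vec Letter n)
  (φ : Fin p ⊎ Fin q → Fin n)
  (φ-adj : ∀ u v → bipAdj E u v ≡ ParikhAdj w (φ u) (φ v)) where

  letterOf : Fin p ⊎ Fin q → Letter
  letterOf u = lookup w (φ u)

  -- The letter, flipped on the Y side: unchanged along every edge of G.
  colour : Fin p ⊎ Fin q → Letter
  colour (inj₁ x) = letterOf (inj₁ x)
  colour (inj₂ y) = flip (letterOf (inj₂ y))

  colour-edge : ∀ u v → bipAdj E u v ≡ true → colour u ≡ colour v
  colour-edge (inj₁ x) (inj₂ y) e =
    adjacent⇒flipped w (φ (inj₁ x)) (φ (inj₂ y)) (trans (sym (φ-adj (inj₁ x) (inj₂ y))) e)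
  colour-edge (inj₂ y) (inj₁ x) e = sym (colour-edge (inj₁ x) (inj₂ y) e)

  colour-walk : ∀ {u v} → Walk (bipAdj E) u v → colour u ≡ colour v
  colour-walk here = refl
  colour-walk (step {u} {v} e walk) = trans (colour-edge u v e) (colour-walk walk)

  restrict : ∀ {x x'} → Nbhd⊆ w (φ (inj₁ x)) (φ (inj₁ x')) → NbhdSubset E x x'
  restrict {x} {x'} nested y e = trans (φ-adj (inj₁ x') (inj₂ y))
    (nested (φ (inj₂ y)) (trans (sym (φ-adj (inj₁ x) (inj₂ y))) e))

  -- In a connected graph all X-vertices carry one letter, so their
  -- neighbourhoods are nested in G(w), hence in G.
  nested : Connected (bipAdj E) → ∀ x x' → NbhdSubset E x x' ⊎ NbhdSubset E x' x
  nested (_ , walk) x x' with ≤-total (toℕ (φ (inj₁ x))) (toℕ (φ (inj₁ x')))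
  ... | inj₁ x-first = Sum.map restrict restrict
    (sameLetter⇒nested w (colour-walk (walk (inj₁ x) (inj₁ x'))) refl x-first)
  ... | inj₂ x'-first = Sum.map restrict restrict
    (swap (sameLetter⇒nested w (colour-walk (walk (inj₁ x') (inj₁ x))) refl x'-first))

-- Sufficiency: nested X-neighbourhoods give a Parikh representation

representedBy : {V : Set} {n : ℕ} {A : V → V → Bool} (w : Vec Letter n) (σ : V ↔ Fin n) →
  (∀ u v → A u v ≡ ParikhAdj w (Inverse.to σ u) (Inverse.to σ v)) → V →
  ParikhBinaryRepresentable A
representedBy {n = zero} w σ _ v with Inverse.to σ v
... | ()
representedBy {n = suc m} w σ σ-adj _ = m , w , σ , σ-adj

module Sufficiency {p q : ℕ} (E : BipGraph p q)
  (chain : ∀ (x x' : Fin p) → NbhdSubset E x x' ⊎ NbhdSubset E x' x) where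

  degree : Fin p → ℕ
  degree x = count (E x)

  richerThan : Fin p → Fin p → Bool
  richerThan x x' = degree x <ᵇ degree x'

  richer : Fin p → ℕ
  richer x = count (richerThan x)

  neighbourOf : Fin q → Fin p → Bool
  neighbourOf y x = E x y

  coDegree : Fin q → ℕ
  coDegree y = count (neighbourOf y)

  degree-upward : ∀ {x x' y} → E x y ≡ true → degree x ≤ degree x' → E x' y ≡ true
  degree-upward {x} {x'} {y} e deg≤ with chain x x' | E x' y Bool.≟ true
  ... | inj₁ x⊆x' | _     = x⊆x' y e
  ... | inj₂ _    | yes e' = e'
  ... | inj₂ x'⊆x | no ¬e' = contradiction deg≤ (<⇒≱ (count-strict (E x') (E x) x'⊆x y ¬e' e))

  edge⇒threshold : ∀ {x y} → E x y ≡ true → richer x < coDegree y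
  edge⇒threshold {x} {y} e = count-strict (richerThan x) (neighbourOf y)
    (λ x' x<x' → degree-upward e (<⇒≤ (<ᵇ-true⁻¹ (degree x) (degree x') x<x')))
    x (<ᵇ-irrefl (degree x)) e

  nonedge⇒threshold : ∀ {x y} → ¬ (E x y ≡ true) → coDegree y ≤ richer x
  nonedge⇒threshold {x} {y} ¬e = count-mono (neighbourOf y) (richerThan x) λ x' e' →
    <ᵇ-true (≰⇒> λ deg≤ → ¬e (degree-upward e' deg≤))

  key : Fin p ⊎ Fin q → ℕ
  key (inj₁ x) = suc (2 * richer x)
  key (inj₂ y) = 2 * coDegree y

  key-edge : ∀ {x y} → E x y ≡ true → key (inj₁ x) < key (inj₂ y)
  key-edge {x} {y} e = subst (_≤ 2 * coDegree y) (*-suc 2 (richer x)) (*-monoʳ-≤ 2 (edge⇒threshold e))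

  key-nonedge : ∀ {x y} → ¬ (E x y ≡ true) → key (inj₂ y) < key (inj₁ x)
  key-nonedge ¬e = s≤s (*-monoʳ-≤ 2 (nonedge⇒threshold ¬e))

  sorted : Σ ((Fin p ⊎ Fin q) ↔ Fin (p + q)) λ σ → ∀ {u v} → key u < key v →
    toℕ (Inverse.to σ u) < toℕ (Inverse.to σ v)
  sorted = sortBy (↔-sym (+↔⊎ {p} {q})) key

  σ : (Fin p ⊎ Fin q) ↔ Fin (p + q)
  σ = proj₁ sorted
  open Inverse σ using (to; from; strictlyInverseʳ)

  side : Fin p ⊎ Fin q → Letter
  side (inj₁ _) = a
  side (inj₂ _) = b

  word : Vec Letter (p + q)
  word = tabulate (side ∘ from)

  word-at : ∀ u → lookup word (to u) ≡ side u
  word-at u = trans (lookup∘tabulate (side ∘ from) (to u)) (cong side (strictlyInverseʳ u))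

  edge⇔before : ∀ x y → E x y ≡ true ⇔ toℕ (to (inj₁ x)) < toℕ (to (inj₂ y))
  edge⇔before x y = mk⇔ (proj₂ sorted {inj₁ x} {inj₂ y} ∘ key-edge) before⇒edge
    where
    before⇒edge : toℕ (to (inj₁ x)) < toℕ (to (inj₂ y)) → E x y ≡ true
    before⇒edge before with E x y Bool.≟ true
    ... | yes e = e
    ... | no ¬e = contradiction before (<-asym (proj₂ sorted {inj₂ y} {inj₁ x} (key-nonedge ¬e)))

  represents : ∀ u v → bipAdj E u v ≡ ParikhAdj word (to u) (to v)
  represents (inj₁ x) (inj₁ x') =
    sym (sameLetter⇒nonadjacent word _ _ (trans (word-at (inj₁ x)) (sym (word-at (inj₁ x')))))
  represents (inj₂ y) (inj₂ y') =
    sym (sameLetter⇒nonadjacent word _ _ (trans (word-at (inj₂ y)) (sym (word-at (inj₂ y')))))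
  represents (inj₁ x) (inj₂ y) = ⇔→≡
    (⇔-sym (adjacent⇔before word _ _ (word-at (inj₁ x)) (word-at (inj₂ y))) ⇔-∘ edge⇔before x y)
  represents (inj₂ y) (inj₁ x) = trans (represents (inj₁ x) (inj₂ y)) (parikhAdj-sym word (to (inj₁ x)) (to (inj₂ y)))

  representable : Fin p ⊎ Fin q → ParikhBinaryRepresentable (bipAdj E)
  representable = representedBy word σ represents

theorem6p1 : (p q : ℕ) (E : BipGraph p q) → Connected (bipAdj E) →
    (ParikhBinaryRepresentable (bipAdj E) ⇔
      (∀ (x x' : Fin p) → NbhdSubset E x x' ⊎ NbhdSubset E x' x))
theorem6p1 p q E connected = mk⇔
  (λ { (_ , w , σ , σ-adj) → Necessity.nested E w (Inverse.to σ) σ-adj connected })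
  (λ chain → Sufficiency.representable E chain (proj₁ connected))
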